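{- Let $a,b$ be positive integers, $P=[a]\times[b]$, $\mathbb{S}$ a skew field of characteristic zero and $C$ a generic element of the center of $\mathbb{S}$. For a (generic) labeling $g\in\mathbb{S}^P$, $\operatorname{ST}_{\operatorname{NAR}(g)}(i)=\operatorname{ST}_g(i-1)$ for $2\leq i\leq a+b$ and $\operatorname{ST}_{\operatorname{NAR}(g)}(1)=\operatorname{ST}_g(a+b)$.
   Context: $[n]=\{1,\dots,n\}$; $P=[a]\times[b]$ has componentwise order, and $(i,j)$ is covered exactly by $(i+1,j)$ and $(i,j+1)$ when these lie in $P$. Write $\overline{x}=x^{ -1}$ for $x\in\mathbb{S}$. All maps are rational maps on $\mathbb{S}^P$ (labelings $P\to\mathbb{S}$), defined for generic labelings. Define: $(\Theta f)(x)=C\cdot\overline{f(x)}$; $(\nabla f)(x)=f(x)\cdot\overline{\sum_{y\lessdot x}f(y)}$, where the empty sum (for $x$ minimal) is replaced by $1$; $(\Delta^{ -1}f)(x)=\sum f(y_k)\cdots f(y_2)f(y_1)$ over all saturated chains $x=y_1\lessdot y_2\lessdot\cdots\lessdot y_k$ with $y_k$ maximal in $P$, equivalently $(\Delta^{ -1}f)(x)=\big(\sum_{y\gtrdot x}(\Delta^{ -1}f)(y)\big)\cdot f(x)$ with the empty sum equal to $1$. Noncommutative antichain rowmotion is $\operatorname{NAR}=\nabla\circ\Theta\circ\Delta^{ -1}$. The Stanley--Thomas word of $g$ is the $(a+b)$-tuple with $\operatorname{ST}_g(i)=g(i,b)\cdot g(i,b-1)\cdots g(i,1)$ for $1\le i\le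 a$ and $\operatorname{ST}_g(i)=C\cdot\overline{g(1,i-a)}\cdot\overline{g(2,i-a)}\cdots\overline{g(a,i-a)}$ for $a+1\le i\le a+b$. -}

module Defs where

open import Level using (Level; _⊔_)
open import Algebra.Bundles using (Ring)
open import Data.Nat as ℕ using (ℕ; zero; suc; _∸_; _≤?_)
open import Relation.Nullary using (¬_; yes; no)

-- A skew field (division ring): a ring with 1 ≉ 0 in which every nonzero
-- element has a two-sided inverse.  The inverse is a total operation whose
-- value at 0 is irrelevant (junk).
record SkewField (c ℓ : Level) : Set (Level.suc (c ⊔ ℓ)) where
  field
    ring : Ring c ℓ
  open Ring ring public
  field
    inv        : Carrier → Carrier
    1#≉0#      : ¬ (1# ≈ 0#)
    inv-inverseˡ : ∀ x → ¬ (x ≈ 0#) → (inv x * x) ≈ 1#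
    inv-inverseʳ : ∀ x → ¬ (x ≈ 0#) → (x * inv x) ≈ 1#

module _ {c ℓ} (S : SkewField c ℓ) where
  open SkewField S using (Carrier; _≈_; _+_; _*_; 0#; 1#; inv)

  natEmb : ℕ → Carrier
  natEmb zero    = 0#
  natEmb (suc n) = 1# + natEmb n

  CharZero : Set ℓ
  CharZero = ∀ n → ¬ (natEmb (suc n) ≈ 0#)

  IsCentral : Carrier → Set (c ⊔ ℓ)
  IsCentral z = ∀ x → (z * x) ≈ (x * z)

  -- Labelings of P = [a] × [b]: functions ℕ → ℕ → S, of which only the
  -- values at (i , j) with 1 ≤ i ≤ a, 1 ≤ j ≤ b matter.
  Labeling : Set c
  Labeling = ℕ → ℕ → Carrier

  Θ : Carrier → Labeling → Labeling
  Θ C f i j = C * inv (f i j)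

  -- Sum over lower covers of (i , j) (empty sum replaced by 1)
  lowerSum : Labeling → ℕ → ℕ → Carrier
  lowerSum f (suc (suc i)) (suc (suc j)) = f (suc i) (suc (suc j)) + f (suc (suc i)) (suc j)
  lowerSum f (suc (suc i)) j             = f (suc i) j
  lowerSum f i             (suc (suc j)) = f i (suc j)
  lowerSum f i             j             = 1#

  ∇ : Labeling → Labeling
  ∇ f i j = f i j * inv (lowerSum f i j)

  -- Δ⁻¹ via the recursion (Δ⁻¹f)(x) = (Σ_{y ⋗ x} (Δ⁻¹f)(y)) · f(x),
  -- empty sum = 1.  R u v is the value at (a ∸ u , b ∸ v).
  module _ (a b : ℕ) (f : Labeling) where
    R : ℕ → ℕ → Carrier
    R zero    zero    = f a b
    R (suc u) zero    = R u zero * f (a ∸ suc u) b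
    R zero    (suc v) = R zero v * f a (b ∸ suc v)
    R (suc u) (suc v) = (R u (suc v) + R (suc u) v) * f (a ∸ suc u) (b ∸ suc v)

  Δinv : ℕ → ℕ → Labeling → Labeling
  Δinv a b f i j = R a b f (a ∸ i) (b ∸ j)

  NAR : ℕ → ℕ → Carrier → Labeling → Labeling
  NAR a b C f = ∇ (Θ C (Δinv a b f))

  rowProd : Labeling → ℕ → ℕ → Carrier
  rowProd g i zero    = 1#
  rowProd g i (suc j) = g i (suc j) * rowProd g i j

  colInvProd : Labeling → ℕ → ℕ → Carrier
  colInvProd g k zero    = 1#
  colInvProd g k (suc m) = colInvProd g k m * inv (g (suc m) k)

  ST : ℕ → ℕ → Carrier → Labeling → ℕ → Carrier
  ST a b C g i with i ≤? a
  ... | yes _ = rowProd g i b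
  ... | no  _ = C * colInvProd g (i ∸ a) a

  -- Genericity: every element that gets inverted in computing NAR(g),
  -- ST_g and ST_{NAR(g)} is nonzero.
  Generic : ℕ → ℕ → Carrier → Labeling → Set ℓ
  Generic a b C g =
    ∀ i j → 1 ℕ.≤ i → i ℕ.≤ a → 1 ℕ.≤ j → j ℕ.≤ b →
      (¬ (g i j ≈ 0#))
    × (¬ (Δinv a b g i j ≈ 0#))
    × (¬ (lowerSum (Θ C (Δinv a b g)) i j ≈ 0#))
    × (¬ (NAR a b C g i j ≈ 0#))
    where open import Data.Product using (_×_)

-- Write D = Δ⁻¹ g and N = NAR g.  Since N x = C · (D x)⁻¹ · (Σ_{y ⋖ x} C · (D y)⁻¹)⁻¹, the product
-- D x · N x depends only on the lower covers of x: it is C at the minimum, D y when y is the only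
-- lower cover, and D p · g w · (D w)⁻¹ · D q when x covers p and q, which both cover w (the
-- noncommutative harmonic mean (p⁻¹ + q⁻¹)⁻¹ = p (q + p)⁻¹ q, together with D w = (D q + D p) · g w).
-- Hence D(i,b) · N(i,b) ⋯ N(i,1) telescopes to D(i-1,b) · g(i-1,b-1) ⋯ g(i-1,1), and cancelling
-- D(i,b) against D(i-1,b) = D(i,b) · g(i-1,b) gives ST_N(i) = ST_g(i-1).  Columns telescope in the
-- same way after inverting the column products.  On row 1 and column 1 the products telescope to C,
-- and D(1,b), D(a,1) are the full column and row products of g, which yields the wrap-around entry
-- and the entry at a + 1.

module Submission where

open import Defs
open import Data.Empty using (⊥-elim)
open import Data.Nat as ℕ using (ℕ; zero; suc; 2+; _∸_; _≤_; _<_; z≤n; s≤s; z<s; _≤?_)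
open import Data.Nat.Properties as ℕₚ
  using (<⇒≤; ≤-refl; n<1+n; m<n⇒m<1+n; n∸n≡0; m∸[m∸n]≡n; m+n∸m≡n; m+1+n≰m; ≤-<-connex;
         m≤n⇒∃[o]m+o≡n; +-cancelˡ-<; +-suc)
open import Data.Product using (_×_; _,_; proj₁; proj₂)
open import Data.Sum using (inj₁; inj₂)
open import Function using (_∘_; flip)
open import Relation.Nullary using (¬_; yes; no)
open import Relation.Binary.PropositionalEquality as ≡ using (_≡_; cong)

m∸n≡1+[m∸1+n] : ∀ {m n} → n < m → m ∸ n ≡ suc (m ∸ suc n)
m∸n≡1+[m∸1+n] {suc m} {zero}  _         = ≡.refl
m∸n≡1+[m∸1+n] {suc m} {suc n} (s≤s n<m) = m∸n≡1+[m∸1+n] n<m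

m∸1+[m∸1+n]≡n : ∀ {m n} → n < m → m ∸ suc (m ∸ suc n) ≡ n
m∸1+[m∸1+n]≡n n<m rewrite ≡.sym (m∸n≡1+[m∸1+n] n<m) = m∸[m∸n]≡n (<⇒≤ n<m)

module SkewFieldProperties {c ℓ} (S : SkewField c ℓ) where
  open SkewField S
  open import Relation.Binary.Reasoning.Setoid setoid

  infix 8 _⁻¹
  _⁻¹ : Carrier → Carrier
  _⁻¹ = inv

  x*y*y⁻¹≈x : ∀ x {y} → y ≉ 0# → x * y * y ⁻¹ ≈ x
  x*y*y⁻¹≈x x {y} y≉0 = begin
    x * y * y ⁻¹   ≈⟨ *-assoc x y (y ⁻¹) ⟩
    x * (y * y ⁻¹) ≈⟨ *-congˡ (inv-inverseʳ y y≉0) ⟩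
    x * 1#         ≈⟨ *-identityʳ x ⟩
    x              ∎

  y⁻¹*[y*x]≈x : ∀ x {y} → y ≉ 0# → y ⁻¹ * (y * x) ≈ x
  y⁻¹*[y*x]≈x x {y} y≉0 = begin
    y ⁻¹ * (y * x) ≈⟨ *-assoc (y ⁻¹) y x ⟨
    y ⁻¹ * y * x   ≈⟨ *-congʳ (inv-inverseˡ y y≉0) ⟩
    1# * x         ≈⟨ *-identityˡ x ⟩
    x              ∎

  *-cancelˡ : ∀ {x y z} → z ≉ 0# → z * x ≈ z * y → x ≈ y
  *-cancelˡ {x} {y} {z} z≉0 zx≈zy = begin
    x              ≈⟨ y⁻¹*[y*x]≈x x z≉0 ⟨
    z ⁻¹ * (z * x) ≈⟨ *-congˡ zx≈zy ⟩
    z ⁻¹ * (z * y) ≈⟨ y⁻¹*[y*x]≈x y z≉0 ⟩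
    y              ∎

  *-cancelʳ : ∀ {x y z} → z ≉ 0# → x * z ≈ y * z → x ≈ y
  *-cancelʳ {x} {y} {z} z≉0 xz≈yz = begin
    x            ≈⟨ x*y*y⁻¹≈x x z≉0 ⟨
    x * z * z ⁻¹ ≈⟨ *-congʳ xz≈yz ⟩
    y * z * z ⁻¹ ≈⟨ x*y*y⁻¹≈x y z≉0 ⟩
    y            ∎

  *-≉0 : ∀ {x y} → x ≉ 0# → y ≉ 0# → x * y ≉ 0#
  *-≉0 {x} {y} x≉0 y≉0 xy≈0 = x≉0 (begin
    x            ≈⟨ x*y*y⁻¹≈x x y≉0 ⟨
    x * y * y ⁻¹ ≈⟨ *-congʳ xy≈0 ⟩
    0# * y ⁻¹    ≈⟨ zeroˡ (y ⁻¹) ⟩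
    0#           ∎)

  ⁻¹-≉0 : ∀ {x} → x ≉ 0# → x ⁻¹ ≉ 0#
  ⁻¹-≉0 {x} x≉0 x⁻¹≈0 = 1#≉0# (begin
    1#       ≈⟨ inv-inverseˡ x x≉0 ⟨
    x ⁻¹ * x ≈⟨ *-congʳ x⁻¹≈0 ⟩
    0# * x   ≈⟨ zeroˡ x ⟩
    0#       ∎)

  inverseˡ-unique : ∀ {x y} → y ≉ 0# → x * y ≈ 1# → x ≈ y ⁻¹
  inverseˡ-unique {x} {y} y≉0 xy≈1 = *-cancelʳ y≉0 (trans xy≈1 (sym (inv-inverseˡ y y≉0)))

  ⁻¹-cong : ∀ {x y} → x ≉ 0# → x ≈ y → x ⁻¹ ≈ y ⁻¹
  ⁻¹-cong {x} {y} x≉0 x≈y =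
    inverseˡ-unique (x≉0 ∘ trans x≈y) (trans (*-congˡ (sym x≈y)) (inv-inverseˡ x x≉0))

  ⁻¹-anti-homo-* : ∀ {x y} → x ≉ 0# → y ≉ 0# → (x * y) ⁻¹ ≈ y ⁻¹ * x ⁻¹
  ⁻¹-anti-homo-* {x} {y} x≉0 y≉0 = sym (inverseˡ-unique (*-≉0 x≉0 y≉0) (begin
    y ⁻¹ * x ⁻¹ * (x * y)   ≈⟨ *-assoc (y ⁻¹) (x ⁻¹) (x * y) ⟩
    y ⁻¹ * (x ⁻¹ * (x * y)) ≈⟨ *-congˡ (y⁻¹*[y*x]≈x y x≉0) ⟩
    y ⁻¹ * y                ≈⟨ inv-inverseˡ y y≉0 ⟩
    1#                      ∎))

  1⁻¹≈1 : 1# ⁻¹ ≈ 1#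
  1⁻¹≈1 = sym (inverseˡ-unique 1#≉0# (*-identityˡ 1#))

  x*y≈z⇒x≈z*y⁻¹ : ∀ {x y z} → y ≉ 0# → x * y ≈ z → x ≈ z * y ⁻¹
  x*y≈z⇒x≈z*y⁻¹ {x} {y} {z} y≉0 xy≈z = trans (sym (x*y*y⁻¹≈x x y≉0)) (*-congʳ xy≈z)

  x*y≈z⇒y≈x⁻¹*z : ∀ {x y z} → x ≉ 0# → x * y ≈ z → y ≈ x ⁻¹ * z
  x*y≈z⇒y≈x⁻¹*z {x} {y} {z} x≉0 xy≈z = trans (sym (y⁻¹*[y*x]≈x y x≉0)) (*-congˡ xy≈z)

  -- With t = p (q + p)⁻¹ this says t q = (p⁻¹ + q⁻¹)⁻¹.
  harmonic : ∀ {p q t} → p ≉ 0# → q ≉ 0# → t * (q + p) ≈ p → t * q * (p ⁻¹ + q ⁻¹) ≈ 1#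
  harmonic {p} {q} {t} p≉0 q≉0 t[q+p]≈p = begin
    t * q * (p ⁻¹ + q ⁻¹)                 ≈⟨ distribˡ (t * q) (p ⁻¹) (q ⁻¹) ⟩
    t * q * p ⁻¹ + t * q * q ⁻¹           ≈⟨ +-congˡ (x*y*y⁻¹≈x t q≉0) ⟩
    t * q * p ⁻¹ + t                      ≈⟨ +-congˡ (x*y*y⁻¹≈x t p≉0) ⟨
    t * q * p ⁻¹ + t * p * p ⁻¹           ≈⟨ distribʳ (p ⁻¹) (t * q) (t * p) ⟨
    (t * q + t * p) * p ⁻¹                ≈⟨ *-congʳ (distribˡ t q p) ⟨
    t * (q + p) * p ⁻¹                    ≈⟨ *-congʳ t[q+p]≈p ⟩
    p * p ⁻¹                              ≈⟨ inv-inverseʳ p p≉0 ⟩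
    1#                                    ∎

  module _ {C : Carrier} (C-central : IsCentral S C) where

    x*[C*x⁻¹*y]≈C*y : ∀ {x} y → x ≉ 0# → x * (C * x ⁻¹ * y) ≈ C * y
    x*[C*x⁻¹*y]≈C*y {x} y x≉0 = begin
      x * (C * x ⁻¹ * y)   ≈⟨ *-assoc x (C * x ⁻¹) y ⟨
      x * (C * x ⁻¹) * y   ≈⟨ *-congʳ (*-assoc x C (x ⁻¹)) ⟨
      x * C * x ⁻¹ * y     ≈⟨ *-congʳ (*-congʳ (C-central x)) ⟨
      C * x * x ⁻¹ * y     ≈⟨ *-congʳ (x*y*y⁻¹≈x C x≉0) ⟩
      C * y                ∎

    C*[C*p⁻¹]⁻¹≈p : ∀ {p} → C ≉ 0# → p ≉ 0# → C * (C * p ⁻¹) ⁻¹ ≈ p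
    C*[C*p⁻¹]⁻¹≈p {p} C≉0 p≉0 = begin
      C * (C * p ⁻¹) ⁻¹              ≈⟨ x*[C*x⁻¹*y]≈C*y ((C * p ⁻¹) ⁻¹) p≉0 ⟨
      p * (C * p ⁻¹ * (C * p ⁻¹) ⁻¹) ≈⟨ *-congˡ (inv-inverseʳ (C * p ⁻¹) (*-≉0 C≉0 (⁻¹-≉0 p≉0))) ⟩
      p * 1#                         ≈⟨ *-identityʳ p ⟩
      p                              ∎

    C*[C*p⁻¹+C*q⁻¹]⁻¹≈p*h*w⁻¹*q : ∀ {p q h w} → p ≉ 0# → q ≉ 0# → h ≉ 0# → w ≉ 0# →
      C * p ⁻¹ + C * q ⁻¹ ≉ 0# → w ≈ (q + p) * h →
      C * (C * p ⁻¹ + C * q ⁻¹) ⁻¹ ≈ p * h * w ⁻¹ * q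
    C*[C*p⁻¹+C*q⁻¹]⁻¹≈p*h*w⁻¹*q {p} {q} {h} {w} p≉0 q≉0 h≉0 w≉0 L≉0 w≈[q+p]h =
      sym (x*y≈z⇒x≈z*y⁻¹ L≉0 (begin
        t * q * (C * p ⁻¹ + C * q ⁻¹)   ≈⟨ *-congˡ (distribˡ C (p ⁻¹) (q ⁻¹)) ⟨
        t * q * (C * (p ⁻¹ + q ⁻¹))     ≈⟨ *-assoc (t * q) C _ ⟨
        t * q * C * (p ⁻¹ + q ⁻¹)       ≈⟨ *-congʳ (C-central (t * q)) ⟨
        C * (t * q) * (p ⁻¹ + q ⁻¹)     ≈⟨ *-assoc C (t * q) _ ⟩
        C * (t * q * (p ⁻¹ + q ⁻¹))     ≈⟨ *-congˡ (harmonic p≉0 q≉0 t[q+p]≈p) ⟩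
        C * 1#                          ≈⟨ *-identityʳ C ⟩
        C                               ∎))
      where
      t = p * h * w ⁻¹
      t[q+p]≈p : t * (q + p) ≈ p
      t[q+p]≈p = begin
        p * h * w ⁻¹ * (q + p)          ≈⟨ *-congˡ (x*y≈z⇒x≈z*y⁻¹ h≉0 (sym w≈[q+p]h)) ⟩
        p * h * w ⁻¹ * (w * h ⁻¹)       ≈⟨ *-assoc (p * h) (w ⁻¹) _ ⟩
        p * h * (w ⁻¹ * (w * h ⁻¹))     ≈⟨ *-congˡ (y⁻¹*[y*x]≈x (h ⁻¹) w≉0) ⟩
        p * h * h ⁻¹                    ≈⟨ x*y*y⁻¹≈x p h≉0 ⟩
        p                               ∎

module LabelingProperties {c ℓ} (S : SkewField c ℓ) where
  open SkewField S
  open SkewFieldProperties S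
  open import Relation.Binary.Reasoning.Setoid setoid

  module _ (a b : ℕ) (f : Labeling S) where

    Δinv-recurrence : ∀ {i j} → i < a → j < b →
      Δinv S a b f i j ≡ (Δinv S a b f (suc i) j + Δinv S a b f i (suc j)) * f i j
    Δinv-recurrence {i} {j} i<a j<b
      rewrite m∸n≡1+[m∸1+n] i<a | m∸n≡1+[m∸1+n] j<b
            | m∸1+[m∸1+n]≡n i<a | m∸1+[m∸1+n]≡n j<b = ≡.refl

    Δinv-recurrence-column-b : ∀ {i} → i < a → Δinv S a b f i b ≡ Δinv S a b f (suc i) b * f i b
    Δinv-recurrence-column-b {i} i<a
      rewrite n∸n≡0 b | m∸n≡1+[m∸1+n] i<a | m∸1+[m∸1+n]≡n i<a = ≡.refl

    Δinv-recurrence-row-a : ∀ {j} → j < b → Δinv S a b f a j ≡ Δinv S a b f a (suc j) * f a j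
    Δinv-recurrence-row-a {j} j<b
      rewrite n∸n≡0 a | m∸n≡1+[m∸1+n] j<b | m∸1+[m∸1+n]≡n j<b = ≡.refl

  rowProd-from-prefixes : ∀ (h : Labeling S) i n (r : ℕ → Carrier) →
    r 0 ≡ h i (suc n) → (∀ v → r (suc v) ≡ r v * h i (n ∸ v)) →
    r n ≈ rowProd S h i (suc n)
  rowProd-from-prefixes h i n r r₀ r-suc = begin
    r n                         ≈⟨ *-identityʳ (r n) ⟨
    r n * 1#                    ≡⟨ cong (λ k → r n * rowProd S h i k) (≡.sym (n∸n≡0 n)) ⟩
    r n * rowProd S h i (n ∸ n) ≈⟨ prefix n ≤-refl ⟩
    rowProd S h i (suc n)       ∎
    where
    unfold : ∀ {v} → v < n → h i (n ∸ v) * rowProd S h i (n ∸ suc v) ≡ rowProd S h i (n ∸ v)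
    unfold v<n rewrite m∸n≡1+[m∸1+n] v<n = ≡.refl

    prefix : ∀ v → v ≤ n → r v * rowProd S h i (n ∸ v) ≈ rowProd S h i (suc n)
    prefix zero    _   = reflexive (cong (_* rowProd S h i n) r₀)
    prefix (suc v) v<n = begin
      r (suc v) * rowProd S h i (n ∸ suc v)             ≡⟨ cong (_* rowProd S h i (n ∸ suc v)) (r-suc v) ⟩
      r v * h i (n ∸ v) * rowProd S h i (n ∸ suc v)     ≈⟨ *-assoc (r v) _ _ ⟩
      r v * (h i (n ∸ v) * rowProd S h i (n ∸ suc v))   ≡⟨ cong (r v *_) (unfold v<n) ⟩
      r v * rowProd S h i (n ∸ v)                       ≈⟨ prefix v (<⇒≤ v<n) ⟩
      rowProd S h i (suc n)                             ∎

  Δinv-corner-a1 : ∀ a b f → Δinv S (suc a) (suc b) f (suc a) 1 ≈ rowProd S f (suc a) (suc b)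
  Δinv-corner-a1 a b f = begin
    R′ (a ∸ a) b                ≡⟨ cong (λ u → R′ u b) (n∸n≡0 a) ⟩
    R′ 0 b                      ≈⟨ rowProd-from-prefixes f (suc a) b (R′ 0) ≡.refl (λ _ → ≡.refl) ⟩
    rowProd S f (suc a) (suc b) ∎
    where R′ = R S (suc a) (suc b) f

  Δinv-corner-1b : ∀ a b f → Δinv S (suc a) (suc b) f 1 (suc b) ≈ rowProd S (flip f) (suc b) (suc a)
  Δinv-corner-1b a b f = begin
    R′ a (b ∸ b)                       ≡⟨ cong (R′ a) (n∸n≡0 b) ⟩
    R′ a 0                             ≈⟨ rowProd-from-prefixes (flip f) (suc b) a (λ u → R′ u 0) ≡.refl (λ _ → ≡.refl) ⟩
    rowProd S (flip f) (suc b) (suc a) ∎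
    where R′ = R S (suc a) (suc b) f

  rowProd-≉0 : ∀ (h : Labeling S) i n → (∀ {j} → j < n → h i (suc j) ≉ 0#) → rowProd S h i n ≉ 0#
  rowProd-≉0 h i zero    _     = 1#≉0#
  rowProd-≉0 h i (suc n) h≉0 = *-≉0 (h≉0 (n<1+n n)) (rowProd-≉0 h i n (h≉0 ∘ m<n⇒m<1+n))

  colInvProd≈rowProd⁻¹ : ∀ (h : Labeling S) k m → (∀ {i} → i < m → h (suc i) k ≉ 0#) →
    colInvProd S h k m ≈ rowProd S (flip h) k m ⁻¹
  colInvProd≈rowProd⁻¹ h k zero    _   = sym 1⁻¹≈1
  colInvProd≈rowProd⁻¹ h k (suc m) h≉0 = begin
    colInvProd S h k m * h (suc m) k ⁻¹         ≈⟨ *-congʳ (colInvProd≈rowProd⁻¹ h k m h≉0′) ⟩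
    rowProd S (flip h) k m ⁻¹ * h (suc m) k ⁻¹  ≈⟨ ⁻¹-anti-homo-* (h≉0 (n<1+n m)) (rowProd-≉0 (flip h) k m h≉0′) ⟨
    (h (suc m) k * rowProd S (flip h) k m) ⁻¹   ∎
    where
    h≉0′ : ∀ {i} → i < m → h (suc i) k ≉ 0#
    h≉0′ = h≉0 ∘ m<n⇒m<1+n

  telescope-constant : (x : Labeling S) (r m : ℕ) (d : ℕ → Carrier) (c : Carrier) →
    d 1 * x r 1 ≈ c →
    (∀ {n} → 2+ n ≤ m → d (2+ n) * x r (2+ n) ≈ d (suc n)) →
    ∀ {n} → suc n ≤ m → d (suc n) * rowProd S x r (suc n) ≈ c
  telescope-constant x r m d c base step {zero} _ = begin
    d 1 * (x r 1 * 1#) ≈⟨ *-assoc (d 1) (x r 1) 1# ⟨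
    d 1 * x r 1 * 1#   ≈⟨ *-identityʳ _ ⟩
    d 1 * x r 1        ≈⟨ base ⟩
    c                  ∎
  telescope-constant x r m d c base step {suc n} n+2≤m = begin
    d (2+ n) * (x r (2+ n) * rowProd S x r (suc n)) ≈⟨ *-assoc (d (2+ n)) _ _ ⟨
    d (2+ n) * x r (2+ n) * rowProd S x r (suc n)   ≈⟨ *-congʳ (step n+2≤m) ⟩
    d (suc n) * rowProd S x r (suc n)               ≈⟨ telescope-constant x r m d c base step (<⇒≤ n+2≤m) ⟩
    c                                               ∎

  module Telescope (x h : Labeling S) (r r′ m : ℕ) (d e : ℕ → Carrier)
    (base : d 1 * x r 1 ≈ e 1)
    (step : ∀ {n} → 2+ n ≤ m →
      d (2+ n) * x r (2+ n) ≈ e (2+ n) * h r′ (suc n) * e (suc n) ⁻¹ * d (suc n))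
    (e≉0 : ∀ {n} → 2+ n ≤ m → e (suc n) ≉ 0#)
    where

    telescope : ∀ {n} → suc n ≤ m → d (suc n) * rowProd S x r (suc n) ≈ e (suc n) * rowProd S h r′ n
    telescope {zero} _ = begin
      d 1 * (x r 1 * 1#) ≈⟨ *-assoc (d 1) (x r 1) 1# ⟨
      d 1 * x r 1 * 1#   ≈⟨ *-congʳ base ⟩
      e 1 * 1#           ∎
    telescope {suc n} n+2≤m = begin
      d (2+ n) * (x r (2+ n) * rowProd S x r (suc n))    ≈⟨ *-assoc (d (2+ n)) _ _ ⟨
      d (2+ n) * x r (2+ n) * rowProd S x r (suc n)      ≈⟨ *-congʳ (step n+2≤m) ⟩
      t * d (suc n) * rowProd S x r (suc n)              ≈⟨ *-assoc t _ _ ⟩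
      t * (d (suc n) * rowProd S x r (suc n))            ≈⟨ *-congˡ (telescope (<⇒≤ n+2≤m)) ⟩
      t * (e (suc n) * rowProd S h r′ n)                 ≈⟨ *-assoc (e (2+ n) * h r′ (suc n)) _ _ ⟩
      e (2+ n) * h r′ (suc n) * (e (suc n) ⁻¹ * (e (suc n) * rowProd S h r′ n))
                                                         ≈⟨ *-congˡ (y⁻¹*[y*x]≈x _ (e≉0 n+2≤m)) ⟩
      e (2+ n) * h r′ (suc n) * rowProd S h r′ n         ≈⟨ *-assoc (e (2+ n)) _ _ ⟩
      e (2+ n) * rowProd S h r′ (suc n)                  ∎
      where
      t = e (2+ n) * h r′ (suc n) * e (suc n) ⁻¹

    rowProd-telescope : ∀ {n} → suc n ≤ m → d (suc n) ≉ 0# → e (suc n) ≈ d (suc n) * h r′ (suc n) →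
      rowProd S x r (suc n) ≈ rowProd S h r′ (suc n)
    rowProd-telescope {n} n+1≤m d≉0 e≈dh = *-cancelˡ d≉0 (begin
      d (suc n) * rowProd S x r (suc n)           ≈⟨ telescope n+1≤m ⟩
      e (suc n) * rowProd S h r′ n                ≈⟨ *-congʳ e≈dh ⟩
      d (suc n) * h r′ (suc n) * rowProd S h r′ n ≈⟨ *-assoc (d (suc n)) _ _ ⟩
      d (suc n) * rowProd S h r′ (suc n)          ∎)

  ST-row : ∀ {a} b C h {i} → i ≤ a → ST S a b C h i ≡ rowProd S h i b
  ST-row {a} b C h {i} i≤a with i ≤? a
  ... | yes _   = ≡.refl
  ... | no  i≰a = ⊥-elim (i≰a i≤a)

  ST-column : ∀ a b C h k → ST S a b C h (a ℕ.+ suc k) ≡ C * colInvProd S h (suc k) a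
  ST-column a b C h k with a ℕ.+ suc k ≤? a
  ... | yes a+1+k≤a = ⊥-elim (m+1+n≰m a a+1+k≤a)
  ... | no  _       = cong (λ t → C * colInvProd S h t a) (m+n∸m≡n a (suc k))

module Rowmotion {c ℓ} (S : SkewField c ℓ) (a′ b′ : ℕ) {C : SkewField.Carrier S}
  (C-central : IsCentral S C) (C≉0 : ¬ (SkewField._≈_ S C (SkewField.0# S)))
  (g : Labeling S) (g-generic : Generic S (suc a′) (suc b′) C g) where

  open SkewField S
  open SkewFieldProperties S
  open LabelingProperties S
  open import Relation.Binary.Reasoning.Setoid setoid

  a b : ℕ
  a = suc a′
  b = suc b′

  D N : Labeling S
  D = Δinv S a b g
  N = NAR S a b C g

  module _ {i j} (i<a : i < a) (j<b : j < b) where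
    private
      nonzero = g-generic (suc i) (suc j) z<s i<a z<s j<b

    g≉0 : g (suc i) (suc j) ≉ 0#
    g≉0 = proj₁ nonzero

    D≉0 : D (suc i) (suc j) ≉ 0#
    D≉0 = proj₁ (proj₂ nonzero)

    L≉0 : lowerSum S (Θ S C D) (suc i) (suc j) ≉ 0#
    L≉0 = proj₁ (proj₂ (proj₂ nonzero))

    N≉0 : N (suc i) (suc j) ≉ 0#
    N≉0 = proj₂ (proj₂ (proj₂ nonzero))

  D*N≈C*L⁻¹ : ∀ {i j} → i < a → j < b →
    D (suc i) (suc j) * N (suc i) (suc j) ≈ C * lowerSum S (Θ S C D) (suc i) (suc j) ⁻¹
  D*N≈C*L⁻¹ i<a j<b = x*[C*x⁻¹*y]≈C*y C-central _ (D≉0 i<a j<b)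

  D*N-minimal : D 1 1 * N 1 1 ≈ C
  D*N-minimal = begin
    D 1 1 * N 1 1 ≈⟨ D*N≈C*L⁻¹ z<s z<s ⟩
    C * 1# ⁻¹     ≈⟨ *-congˡ 1⁻¹≈1 ⟩
    C * 1#        ≈⟨ *-identityʳ C ⟩
    C             ∎

  D*N-bottom : ∀ {j} → 2+ j ≤ b → D 1 (2+ j) * N 1 (2+ j) ≈ D 1 (suc j)
  D*N-bottom j+2≤b = trans (D*N≈C*L⁻¹ z<s j+2≤b) (C*[C*p⁻¹]⁻¹≈p C-central C≉0 (D≉0 z<s (<⇒≤ j+2≤b)))

  D*N-left : ∀ {i} → 2+ i ≤ a → D (2+ i) 1 * N (2+ i) 1 ≈ D (suc i) 1
  D*N-left i+2≤a = trans (D*N≈C*L⁻¹ i+2≤a z<s) (C*[C*p⁻¹]⁻¹≈p C-central C≉0 (D≉0 (<⇒≤ i+2≤a) z<s))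

  module _ {i j} (i+2≤a : 2+ i ≤ a) (j+2≤b : 2+ j ≤ b) where
    private
      i<a = <⇒≤ i+2≤a
      j<b = <⇒≤ j+2≤b

      D-recurrence : D (suc i) (suc j) ≈ (D (2+ i) (suc j) + D (suc i) (2+ j)) * g (suc i) (suc j)
      D-recurrence = reflexive (Δinv-recurrence a b g i+2≤a j+2≤b)

    D*N-interior : D (2+ i) (2+ j) * N (2+ i) (2+ j)
                   ≈ D (suc i) (2+ j) * g (suc i) (suc j) * D (suc i) (suc j) ⁻¹ * D (2+ i) (suc j)
    D*N-interior = trans (D*N≈C*L⁻¹ i+2≤a j+2≤b)
      (C*[C*p⁻¹+C*q⁻¹]⁻¹≈p*h*w⁻¹*q C-central (D≉0 i<a j+2≤b) (D≉0 i+2≤a j<b) (g≉0 i<a j<b) (D≉0 i<a j<b)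
        (L≉0 i+2≤a j+2≤b) D-recurrence)

    D*N-interior′ : D (2+ i) (2+ j) * N (2+ i) (2+ j)
                    ≈ D (2+ i) (suc j) * g (suc i) (suc j) * D (suc i) (suc j) ⁻¹ * D (suc i) (2+ j)
    D*N-interior′ = begin
      D (2+ i) (2+ j) * N (2+ i) (2+ j) ≈⟨ D*N≈C*L⁻¹ i+2≤a j+2≤b ⟩
      C * (C * q ⁻¹ + C * p ⁻¹) ⁻¹      ≈⟨ *-congˡ (⁻¹-cong (L≉0 i+2≤a j+2≤b) (+-comm _ _)) ⟩
      C * (C * p ⁻¹ + C * q ⁻¹) ⁻¹      ≈⟨ C*[C*p⁻¹+C*q⁻¹]⁻¹≈p*h*w⁻¹*q C-central (D≉0 i+2≤a j<b) (D≉0 i<a j+2≤b)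
                                             (g≉0 i<a j<b) (D≉0 i<a j<b) (L≉0 i+2≤a j+2≤b ∘ trans (+-comm _ _))
                                             (trans D-recurrence (*-congʳ (+-comm _ _))) ⟩
      p * g (suc i) (suc j) * D (suc i) (suc j) ⁻¹ * q ∎
      where
      p = D (2+ i) (suc j)
      q = D (suc i) (2+ j)

  rowProd-NAR-row : ∀ {i} → 2+ i ≤ a → rowProd S N (2+ i) b ≈ rowProd S g (suc i) b
  rowProd-NAR-row {i} i+2≤a =
    Telescope.rowProd-telescope N g (2+ i) (suc i) b (D (2+ i)) (D (suc i))
      (D*N-left i+2≤a) (D*N-interior i+2≤a) (D≉0 (<⇒≤ i+2≤a) ∘ <⇒≤)
      ≤-refl (D≉0 i+2≤a ≤-refl) (reflexive (Δinv-recurrence-column-b a b g i+2≤a))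

  rowProd-NAR-column : ∀ {k} → 2+ k ≤ b → rowProd S (flip N) (2+ k) a ≈ rowProd S (flip g) (suc k) a
  rowProd-NAR-column {k} k+2≤b =
    Telescope.rowProd-telescope (flip N) (flip g) (2+ k) (suc k) a (λ n → D n (2+ k)) (λ n → D n (suc k))
      (D*N-bottom k+2≤b) (λ i+2≤a → D*N-interior′ i+2≤a k+2≤b) (λ i+2≤a → D≉0 (<⇒≤ i+2≤a) (<⇒≤ k+2≤b))
      ≤-refl (D≉0 ≤-refl k+2≤b) (reflexive (Δinv-recurrence-row-a a b g k+2≤b))

  D[1,b]*rowProd-NAR-row-1≈C : D 1 b * rowProd S N 1 b ≈ C
  D[1,b]*rowProd-NAR-row-1≈C = telescope-constant N 1 b (D 1) C D*N-minimal D*N-bottom ≤-refl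

  D[a,1]*rowProd-NAR-column-1≈C : D a 1 * rowProd S (flip N) 1 a ≈ C
  D[a,1]*rowProd-NAR-column-1≈C = telescope-constant (flip N) 1 a (λ n → D n 1) C D*N-minimal D*N-left ≤-refl

  module _ {k} (k<b : k < b) where

    colInvProd-NAR : colInvProd S N (suc k) a ≈ rowProd S (flip N) (suc k) a ⁻¹
    colInvProd-NAR = colInvProd≈rowProd⁻¹ N (suc k) a (λ i<a → N≉0 i<a k<b)

    colInvProd-g : colInvProd S g (suc k) a ≈ rowProd S (flip g) (suc k) a ⁻¹
    colInvProd-g = colInvProd≈rowProd⁻¹ g (suc k) a (λ i<a → g≉0 i<a k<b)

    rowProd-flip-NAR-≉0 : rowProd S (flip N) (suc k) a ≉ 0#
    rowProd-flip-NAR-≉0 = rowProd-≉0 (flip N) (suc k) a (λ i<a → N≉0 i<a k<b)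

  ST-NAR-row : ∀ {i} → 2+ i ≤ a → ST S a b C N (2+ i) ≈ ST S a b C g (suc i)
  ST-NAR-row {i} i+2≤a = begin
    ST S a b C N (2+ i)   ≡⟨ ST-row b C N i+2≤a ⟩
    rowProd S N (2+ i) b  ≈⟨ rowProd-NAR-row i+2≤a ⟩
    rowProd S g (suc i) b ≡⟨ ≡.sym (ST-row b C g (<⇒≤ i+2≤a)) ⟩
    ST S a b C g (suc i)  ∎

  ST-NAR-column : ∀ k → k < b → ST S a b C N (suc (a ℕ.+ k)) ≈ ST S a b C g (a ℕ.+ k)
  ST-NAR-column zero k<b = begin
    ST S a b C N (suc (a ℕ.+ 0))  ≡⟨ cong (ST S a b C N) (≡.sym (+-suc a 0)) ⟩
    ST S a b C N (a ℕ.+ 1)        ≡⟨ ST-column a b C N 0 ⟩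
    C * colInvProd S N 1 a        ≈⟨ *-congˡ (colInvProd-NAR k<b) ⟩
    C * rowProd S (flip N) 1 a ⁻¹ ≈⟨ x*y≈z⇒x≈z*y⁻¹ (rowProd-flip-NAR-≉0 k<b) D[a,1]*rowProd-NAR-column-1≈C ⟨
    D a 1                         ≈⟨ Δinv-corner-a1 a′ b′ g ⟩
    rowProd S g a b               ≡⟨ ≡.sym (ST-row b C g ≤-refl) ⟩
    ST S a b C g a                ≡⟨ cong (ST S a b C g) (≡.sym (ℕₚ.+-identityʳ a)) ⟩
    ST S a b C g (a ℕ.+ 0)        ∎
  ST-NAR-column (suc k) k<b = begin
    ST S a b C N (suc (a ℕ.+ suc k))      ≡⟨ cong (ST S a b C N) (≡.sym (+-suc a (suc k))) ⟩
    ST S a b C N (a ℕ.+ 2+ k)             ≡⟨ ST-column a b C N (suc k) ⟩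
    C * colInvProd S N (2+ k) a           ≈⟨ *-congˡ (colInvProd-NAR k<b) ⟩
    C * rowProd S (flip N) (2+ k) a ⁻¹    ≈⟨ *-congˡ (⁻¹-cong (rowProd-flip-NAR-≉0 k<b) (rowProd-NAR-column k<b)) ⟩
    C * rowProd S (flip g) (suc k) a ⁻¹   ≈⟨ *-congˡ (colInvProd-g (<⇒≤ k<b)) ⟨
    C * colInvProd S g (suc k) a          ≡⟨ ≡.sym (ST-column a b C g k) ⟩
    ST S a b C g (a ℕ.+ suc k)            ∎

  ST-NAR-shift : ∀ i → 2 ≤ i → i ≤ a ℕ.+ b → ST S a b C N i ≈ ST S a b C g (i ∸ 1)
  ST-NAR-shift (suc (suc i)) (s≤s (s≤s z≤n)) i+2≤a+b with ≤-<-connex (2+ i) a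
  ... | inj₁ i+2≤a = ST-NAR-row i+2≤a
  ... | inj₂ a<i+2 with m≤n⇒∃[o]m+o≡n a<i+2
  ...   | k , ≡.refl = ST-NAR-column k (+-cancelˡ-< a k b i+2≤a+b)

  ST-NAR-1 : ST S a b C N 1 ≈ ST S a b C g (a ℕ.+ b)
  ST-NAR-1 = begin
    ST S a b C N 1                  ≡⟨ ST-row {a} b C N z<s ⟩
    rowProd S N 1 b                 ≈⟨ x*y≈z⇒y≈x⁻¹*z (D≉0 {0} z<s ≤-refl) D[1,b]*rowProd-NAR-row-1≈C ⟩
    D 1 b ⁻¹ * C                    ≈⟨ C-central _ ⟨
    C * D 1 b ⁻¹                    ≈⟨ *-congˡ (⁻¹-cong (D≉0 {0} z<s ≤-refl) (Δinv-corner-1b a′ b′ g)) ⟩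
    C * rowProd S (flip g) b a ⁻¹   ≈⟨ *-congˡ (colInvProd-g ≤-refl) ⟨
    C * colInvProd S g b a          ≡⟨ ≡.sym (ST-column a b C g b′) ⟩
    ST S a b C g (a ℕ.+ b)          ∎

open import Data.Nat using (_+_)

theorem4p5 : ∀ {c ℓ} (S : SkewField c ℓ) → CharZero S →
    (a b : ℕ) → 1 ≤ a → 1 ≤ b →
    (C : SkewField.Carrier S) → IsCentral S C → ¬ (SkewField._≈_ S C (SkewField.0# S)) →
    (g : Labeling S) → Generic S a b C g →
      ((i : ℕ) → 2 ≤ i → i ≤ a + b →
        SkewField._≈_ S (ST S a b C (NAR S a b C g) i) (ST S a b C g (i ∸ 1)))
      × SkewField._≈_ S (ST S a b C (NAR S a b C g) 1) (ST S a b C g (a + b))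
theorem4p5 S _ (suc a′) (suc b′) _ _ C C-central C≉0 g g-generic = ST-NAR-shift , ST-NAR-1
  where open Rowmotion S a′ b′ C-central C≉0 g g-generic
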